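{- Let $n\ge 1$, $V=\{1,\dots,n\}$, and let $\tau$ be the cyclic permutation of $V$ with $\tau(1)=n$ and $\tau(i)=i-1$ for $2\le i\le n$. Equip $\mathbb{Z}^n$ (identified with maps $V\to\mathbb{Z}$) with the multiplication $$(a_1,\dots,a_n)*(b_1,\dots,b_n)=\big(a_1+b_{\tau^{a_1}(1)},\,a_2+b_{\tau^{a_2}(2)},\,\dots,\,a_n+b_{\tau^{a_n}(n)}\big),$$ where $\tau^{a}(i)$ is the unique element of $\{1,\dots,n\}$ congruent to $i-a$ modulo $n$. Then $(a_1,\dots,a_n)$ is invertible in the monoid $(\mathbb{Z}^n,*)$ if and only if the numbers $\tau^{a_1}(1),\tau^{a_2}(2),\dots,\tau^{a_n}(n)$ are pairwise distinct, i.e. if and only if the residues $i-a_i \pmod n$, $i=1,\dots,n$, are pairwise distinct.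
   Context: This multiplication is the one induced on maps $V\to\mathbb{Z}$ by the right action of $\mathbb{Z}$ on $V$ given by $v\cdot k=\tau^k(v)$, via the rule $(\phi_2*\phi_1)(v)=\phi_2(v)+\phi_1(v\cdot\phi_2(v))$. It is associative with identity $(0,\dots,0)$. -}

module Defs where

open import Data.Nat using (ℕ; suc; NonZero)
open import Data.Integer using (ℤ; +_; _+_; _-_; 0ℤ)
open import Data.Integer.DivMod using (_%ℕ_; n%ℕd<d)
open import Data.Fin using (Fin; toℕ; fromℕ<)

-- V = {1,…,n} is modelled as Fin n with element k : Fin n standing for k+1.
-- Elements of ℤ^n are maps V → ℤ.
ℤⁿ : ℕ → Set
ℤⁿ n = Fin n → ℤ

-- τ^a(i): the unique element of V congruent to i - a modulo n.
-- (With the 0-based encoding k ↦ k+1 the shift cancels: the index is (k - a) mod n.)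
τ^ : (n : ℕ) .{{_ : NonZero n}} → ℤ → Fin n → Fin n
τ^ n a k = fromℕ< (n%ℕd<d ((+ toℕ k) - a) n)

_⊛_ : {n : ℕ} .{{_ : NonZero n}} → ℤⁿ n → ℤⁿ n → ℤⁿ n
_⊛_ {n} a b i = a i + b (τ^ n (a i) i)

𝟘 : {n : ℕ} → ℤⁿ n
𝟘 _ = 0ℤ

-- Writing the multiplication as a ⊛ b = a + b ∘ σ a with σ a i = τ^{a_i}(i), the equation
-- a ⊛ b = 0 forces b (σ a i) = - a_i, and since τ^{-a_i} undoes τ^{a_i} this makes
-- j ↦ τ^{b_j}(j) a left inverse of σ a.  Conversely, an injective σ a is a bijection of the
-- finite set V, and b = - a ∘ (σ a)⁻¹ is a two-sided inverse of a.
module Submission where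

open import Defs
open import Algebra.Properties.AbelianGroup using (inverseʳ-unique)
open import Data.Fin using (Fin; toℕ; punchOut)
open import Data.Fin.Properties using (toℕ-fromℕ<; toℕ-injective; toℕ<n; any?; _≟_; punchOut-injective; injective⇒≤)
open import Data.Integer using (+_; 0ℤ; _+_; _-_; _*_; -_; ∣_∣; _/ℕ_; _%ℕ_)
open import Data.Integer.DivMod using (a≡a%ℕn+[a/ℕn]*n; n%ℕd<d)
import Data.Integer.Properties as ℤ
open import Data.Integer.Tactic.RingSolver using (solve-∀)
open import Data.Nat as ℕ using (ℕ; suc; zero; NonZero; _<_)
open import Data.Nat.DivMod using (m<n⇒m%n≡m)
import Data.Nat.Properties as ℕ
open import Data.Product using (Σ; _×_; _,_; proj₁; proj₂)
open import Function.Bundles using (_⇔_; mk⇔)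
open import Function.Definitions using (Injective; Surjective)
open import Relation.Binary.PropositionalEquality using (_≡_; _≢_; refl; sym; trans; cong; subst; module ≡-Reasoning)
open import Relation.Nullary using (yes; no; contradiction)

m*n<n⇒m≡0 : ∀ m n → m ℕ.* n < n → m ≡ 0
m*n<n⇒m≡0 zero    n _  = refl
m*n<n⇒m≡0 (suc m) n lt = contradiction lt (ℕ.≤⇒≯ (ℕ.m≤m+n n (m ℕ.* n)))

injective⇒surjective : ∀ {n} {f : Fin n → Fin n} → Injective _≡_ _≡_ f → Surjective _≡_ _≡_ f
injective⇒surjective {suc n} {f} f-inj y with any? (λ x → f x ≟ y)
... | yes (x , fx≡y) = x , λ { refl → fx≡y }
... | no ∄x = contradiction (injective⇒≤ g-inj) ℕ.1+n≰n
  where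
  -- punching the missed value y out of the codomain gives an injection Fin (suc n) → Fin n
  f≢y : ∀ x → y ≢ f x
  f≢y x y≡fx = ∄x (x , sym y≡fx)
  g : Fin (suc n) → Fin n
  g x = punchOut (f≢y x)
  g-inj : Injective _≡_ _≡_ g
  g-inj {x} {x′} gx≡gx′ = f-inj (punchOut-injective (f≢y x) (f≢y x′) gx≡gx′)

module _ {n : ℕ} .{{_ : NonZero n}} where

  remainder-unique : ∀ {r r′} q q′ → r < n → r′ < n → + r + q * + n ≡ + r′ + q′ * + n → r ≡ r′
  remainder-unique {r} {r′} q q′ r<n r′<n eq =
    ℤ.+-injective (ℤ.i-j≡0⇒i≡j (+ r) (+ r′) (ℤ.∣i∣≡0⇒i≡0 ∣r-r′∣≡0))
    where
    open ≡-Reasoning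
    r-r′≡[q′-q]*n : + r - + r′ ≡ (q′ - q) * + n
    r-r′≡[q′-q]*n = begin
      + r - + r′                                               ≡⟨ rearrange (+ r) (+ r′) q q′ (+ n) ⟩
      ((+ r + q * + n) - (+ r′ + q′ * + n)) + (q′ - q) * + n   ≡⟨ cong (λ x → (x - (+ r′ + q′ * + n)) + (q′ - q) * + n) eq ⟩
      ((+ r′ + q′ * + n) - (+ r′ + q′ * + n)) + (q′ - q) * + n ≡⟨ cong (_+ (q′ - q) * + n) (ℤ.+-inverseʳ (+ r′ + q′ * + n)) ⟩
      0ℤ + (q′ - q) * + n                                      ≡⟨ ℤ.+-identityˡ _ ⟩
      (q′ - q) * + n                                           ∎
      where
      rearrange : ∀ a b c d e → a - b ≡ ((a + c * e) - (b + d * e)) + (d - c) * e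
      rearrange = solve-∀
    ∣r-r′∣≡∣q′-q∣*n : ∣ + r - + r′ ∣ ≡ ∣ q′ - q ∣ ℕ.* n
    ∣r-r′∣≡∣q′-q∣*n = trans (cong ∣_∣ r-r′≡[q′-q]*n) (ℤ.abs-* (q′ - q) (+ n))
    ∣r-r′∣<n : ∣ + r - + r′ ∣ < n
    ∣r-r′∣<n rewrite ℤ.m-n≡m⊖n r r′ = ℕ.≤-<-trans (ℤ.∣m⊝n∣≤m⊔n r r′) (ℕ.⊔-lub r<n r′<n)
    ∣r-r′∣≡0 : ∣ + r - + r′ ∣ ≡ 0
    ∣r-r′∣≡0 = trans ∣r-r′∣≡∣q′-q∣*n
      (cong (ℕ._* n) (m*n<n⇒m≡0 ∣ q′ - q ∣ n (subst (_< n) ∣r-r′∣≡∣q′-q∣*n ∣r-r′∣<n)))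

  [i+j*n]%ℕn≡i%ℕn : ∀ i j → (i + j * + n) %ℕ n ≡ i %ℕ n
  [i+j*n]%ℕn≡i%ℕn i j = remainder-unique ((i + j * + n) /ℕ n) (i /ℕ n + j)
    (n%ℕd<d (i + j * + n) n) (n%ℕd<d i n) (begin
      + ((i + j * + n) %ℕ n) + ((i + j * + n) /ℕ n) * + n ≡⟨ sym (a≡a%ℕn+[a/ℕn]*n (i + j * + n) n) ⟩
      i + j * + n                                         ≡⟨ cong (_+ j * + n) (a≡a%ℕn+[a/ℕn]*n i n) ⟩
      (+ (i %ℕ n) + (i /ℕ n) * + n) + j * + n             ≡⟨ regroup (+ (i %ℕ n)) (i /ℕ n) j (+ n) ⟩
      + (i %ℕ n) + (i /ℕ n + j) * + n                     ∎)
    where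
    open ≡-Reasoning
    regroup : ∀ a b c d → (a + b * d) + c * d ≡ a + (b + c) * d
    regroup = solve-∀

  τ^-inverse : ∀ a k → τ^ n (- a) (τ^ n a k) ≡ k
  τ^-inverse a k = toℕ-injective (begin
    toℕ (τ^ n (- a) (τ^ n a k))  ≡⟨ toℕ-fromℕ< _ ⟩
    (+ toℕ (τ^ n a k) - - a) %ℕ n ≡⟨ cong (λ t → (+ t - - a) %ℕ n) (toℕ-fromℕ< _) ⟩
    (+ (x %ℕ n) - - a) %ℕ n       ≡⟨ cong (_%ℕ n) undo-shift ⟩
    (+ toℕ k + q * + n) %ℕ n      ≡⟨ [i+j*n]%ℕn≡i%ℕn (+ toℕ k) q ⟩
    toℕ k ℕ.% n                   ≡⟨ m<n⇒m%n≡m (toℕ<n k) ⟩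
    toℕ k                         ∎)
    where
    open ≡-Reasoning
    x = + toℕ k - a
    q = - (x /ℕ n)
    undo-shift : + (x %ℕ n) - - a ≡ + toℕ k + q * + n
    undo-shift = begin
      + (x %ℕ n) - - a                              ≡⟨ rearrange (+ (x %ℕ n)) (x /ℕ n) a (+ n) ⟩
      ((+ (x %ℕ n) + (x /ℕ n) * + n) + a) + q * + n ≡⟨ cong (λ t → (t + a) + q * + n) (sym (a≡a%ℕn+[a/ℕn]*n x n)) ⟩
      ((+ toℕ k - a) + a) + q * + n                 ≡⟨ cancel (+ toℕ k) a (q * + n) ⟩
      + toℕ k + q * + n                             ∎
      where
      rearrange : ∀ r s b d → r - - b ≡ ((r + s * d) + b) + (- s) * d
      rearrange = solve-∀
      cancel : ∀ t b c → ((t - b) + b) + c ≡ t + c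
      cancel = solve-∀

  Invertible : ℤⁿ n → Set
  Invertible a = Σ (ℤⁿ n) λ b → (∀ i → (a ⊛ b) i ≡ 𝟘 i) × (∀ i → (b ⊛ a) i ≡ 𝟘 i)

  σ : ℤⁿ n → Fin n → Fin n
  σ a i = τ^ n (a i) i

  rightInverse⇒σ-injective : ∀ a {b} → (∀ i → (a ⊛ b) i ≡ 𝟘 i) → Injective _≡_ _≡_ (σ a)
  rightInverse⇒σ-injective a {b} a⊛b≡𝟘 {i} {j} σi≡σj = begin
    i               ≡⟨ sym (σb-retracts-σa i) ⟩
    σ b (σ a i)     ≡⟨ cong (σ b) σi≡σj ⟩
    σ b (σ a j)     ≡⟨ σb-retracts-σa j ⟩
    j               ∎
    where
    open ≡-Reasoning
    σb-retracts-σa : ∀ i → σ b (σ a i) ≡ i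
    σb-retracts-σa i = begin
      τ^ n (b (σ a i)) (σ a i) ≡⟨ cong (λ c → τ^ n c (σ a i)) (inverseʳ-unique ℤ.+-0-abelianGroup (a i) _ (a⊛b≡𝟘 i)) ⟩
      τ^ n (- a i) (σ a i)     ≡⟨ τ^-inverse (a i) i ⟩
      i                        ∎

  σ-injective⇒invertible : ∀ a → Injective _≡_ _≡_ (σ a) → Invertible a
  σ-injective⇒invertible a σ-inj = b , a⊛b≡𝟘 , b⊛a≡𝟘
    where
    σ⁻¹ : Fin n → Fin n
    σ⁻¹ j = proj₁ (injective⇒surjective σ-inj j)

    σ∘σ⁻¹ : ∀ j → σ a (σ⁻¹ j) ≡ j
    σ∘σ⁻¹ j = proj₂ (injective⇒surjective σ-inj j) refl

    b : ℤⁿ n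
    b j = - a (σ⁻¹ j)

    a⊛b≡𝟘 : ∀ i → (a ⊛ b) i ≡ 𝟘 i
    a⊛b≡𝟘 i = trans (cong (λ k → a i - a k) (σ-inj (σ∘σ⁻¹ (σ a i)))) (ℤ.+-inverseʳ (a i))

    τ^[-a∘σ⁻¹]≡σ⁻¹ : ∀ j → τ^ n (- a (σ⁻¹ j)) j ≡ σ⁻¹ j
    τ^[-a∘σ⁻¹]≡σ⁻¹ j = trans (cong (τ^ n (- a (σ⁻¹ j))) (sym (σ∘σ⁻¹ j))) (τ^-inverse (a (σ⁻¹ j)) (σ⁻¹ j))

    b⊛a≡𝟘 : ∀ j → (b ⊛ a) j ≡ 𝟘 j
    b⊛a≡𝟘 j = trans (cong (λ k → - a (σ⁻¹ j) + a k) (τ^[-a∘σ⁻¹]≡σ⁻¹ j)) (ℤ.+-inverseˡ (a (σ⁻¹ j)))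

mainTheorem2 : (m : ℕ) → (a : ℤⁿ (suc m)) →
    (Σ (ℤⁿ (suc m)) (λ b → (∀ i → (a ⊛ b) i ≡ 𝟘 i) × (∀ i → (b ⊛ a) i ≡ 𝟘 i)))
    ⇔ Injective _≡_ _≡_ (λ i → τ^ (suc m) (a i) i)
mainTheorem2 m a = mk⇔
  (λ (b , a⊛b≡𝟘 , _) → rightInverse⇒σ-injective a {b} a⊛b≡𝟘)
  (σ-injective⇒invertible a)
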